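{- Let $\Sigma=(V,E,\{P_e\}_{e\in E})$ be a signature and $e\in E$. Then $\vdash\phi\to\Box_e\phi$ for each $\phi\in\Phi(\Sigma,\{e\})$.
   Context: A signature is a triple $\Sigma=(V,E,\{P_e\}_{e\in E})$ where $(V,E)$ is a connected undirected graph (loops and multiple edges allowed) and $\{P_e\}$ are pairwise disjoint sets of propositional letters. $Inc(v)$ is the set of edges incident to $v$. $\Phi(\Sigma)$ is the least set of formulas containing $\bot$ and all letters in $\bigcup_e P_e$, closed under $\to$ and under $\Box_e$ for $e\in E$. For $T\subseteq E$, $\Phi(\Sigma,T)$ is the least set containing $\bot$ and $P_t$ for $t\in T$, closed under $\to$, and containing $\Box_t\phi$ for every $t\in T$ and every $\phi\in\Phi(\Sigma)$. A path is a sequence $e_0,v_1,e_1,\dots,v_k,e_k$ ($k\ge0$) of pairwise distinct edges and pairwise distinct vertices with $e_i,e_{i+1}\in Inc(v_{i+1})$. Edge $g$ is a gateway between sets of edges $A$ and $B$ if every path starting with an edge in $A$ and ending with an edge in $B$ contains $g$. $\vdash$ denotes provability in the system with axioms: all propositional tautologies of $\Phi(\Sigma)$; $\Box_e\phi\to\phi$; $\Box_e\phi\to\Box_e\Box_e\phi$; $\neg\Box_e\phi\to\Box_e\neg\Box_e\phi$; $\Box_e(\phi\to\psi)\to(\Box_e\phi\to\Box_e\psi)$; and Gateway $\Box_e(\phi\to\psi)\to(\phi\to\Box_g\psi)$ whenever $g$ is a gateway between $A,B\subseteq E$, $e\in A$, $\phi\in\Phi(\Sigma,A)$, $\psi\in\Phi(\Sigma,B)$;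 and rules Modus Ponens and Necessitation (from $\phi$ infer $\Box_e\phi$). -}

module Defs where

open import Data.Bool using (Bool; true; false; not; _∨_)
open import Data.Product using (Σ; ∃; _×_; _,_; proj₁; proj₂)
open import Data.Sum using (_⊎_)
open import Data.List using (List; []; _∷_)
open import Data.List.Membership.Propositional using (_∈_)
open import Data.List.Relation.Unary.Unique.Propositional using (Unique)
open import Relation.Binary.PropositionalEquality using (_≡_)
open import Relation.Binary.Construct.Closure.ReflexiveTransitive using (Star)

-- An edge e has (unordered) endpoints ends e = (u , w); a loop has u ≡ w.
-- Disjointness of the letter sets is built in: a letter is a pair (e , p)
-- with p : P e.

record Signature : Set₁ where
  field
    V    : Set
    E    : Set
    ends : E → V × V
    P    : E → Set

  Inc : V → E → Set
  Inc v e = (v ≡ proj₁ (ends e)) ⊎ (v ≡ proj₂ (ends e))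

  Adjacent : V → V → Set
  Adjacent u w = ∃ λ e → Inc u e × Inc w e

  field
    connected : ∀ u w → Star Adjacent u w

module _ (S : Signature) where
  open Signature S

  data Form : Set where
    ⊥'  : Form
    var : (e : E) → P e → Form
    _⇒_ : Form → Form → Form
    □   : E → Form → Form

  infixr 5 _⇒_

  ¬' : Form → Form
  ¬' φ = φ ⇒ ⊥'

  data InΦ (T : E → Set) : Form → Set where
    bot  : InΦ T ⊥'
    var  : ∀ {t} (p : P t) → T t → InΦ T (var t p)
    imp  : ∀ {φ ψ} → InΦ T φ → InΦ T ψ → InΦ T (φ ⇒ ψ)
    box  : ∀ {t} (φ : Form) → T t → InΦ T (□ t φ)

  data Walk : E → E → Set where
    stop : (e : E) → Walk e e
    step : (e : E) (v : V) {f h : E} → Inc v e → Inc v f → Walk f h → Walk e h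

  edgesOf : ∀ {a b} → Walk a b → List E
  edgesOf (stop e) = e ∷ []
  edgesOf (step e v _ _ w) = e ∷ edgesOf w

  verticesOf : ∀ {a b} → Walk a b → List V
  verticesOf (stop e) = []
  verticesOf (step e v _ _ w) = v ∷ verticesOf w

  IsPath : ∀ {a b} → Walk a b → Set
  IsPath w = Unique (edgesOf w) × Unique (verticesOf w)

  Gateway : E → (E → Set) → (E → Set) → Set
  Gateway g A B = ∀ {a b} (w : Walk a b) → IsPath w → A a → B b → g ∈ edgesOf w

  eval : (Form → Bool) → Form → Bool
  eval v ⊥' = false
  eval v (var e p) = v (var e p)
  eval v (φ ⇒ ψ) = not (eval v φ) ∨ eval v ψ
  eval v (□ e φ) = v (□ e φ)

  Tautology : Form → Set
  Tautology φ = ∀ (v : Form → Bool) → eval v φ ≡ true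

  data ⊢_ : Form → Set₁ where
    taut : ∀ {φ} → Tautology φ → ⊢ φ
    axT  : ∀ e φ → ⊢ (□ e φ ⇒ φ)
    ax4  : ∀ e φ → ⊢ (□ e φ ⇒ □ e (□ e φ))
    ax5  : ∀ e φ → ⊢ (¬' (□ e φ) ⇒ □ e (¬' (□ e φ)))
    axK  : ∀ e φ ψ → ⊢ (□ e (φ ⇒ ψ) ⇒ (□ e φ ⇒ □ e ψ))
    gateway : ∀ (g : E) (A B : E → Set) → Gateway g A B →
              ∀ e → A e → ∀ φ ψ → InΦ A φ → InΦ B ψ →
              ⊢ (□ e (φ ⇒ ψ) ⇒ (φ ⇒ □ g ψ))
    mp   : ∀ {φ ψ} → ⊢ (φ ⇒ ψ) → ⊢ φ → ⊢ ψ
    nec  : ∀ e {φ} → ⊢ φ → ⊢ □ e φ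

module Submission where

-- The statement is an instance of the Gateway axiom with
-- A = B = {e} and g = e: an edge g is a gateway between {g} and any set B,
-- because every path (indeed every walk) from g begins with g itself.
-- The Gateway axiom then turns any theorem ⊢ φ ⇒ ψ with φ ∈ Φ(Σ,A),
-- ψ ∈ Φ(Σ,B) into ⊢ φ ⇒ □_g ψ, and we apply this to the tautology φ ⇒ φ.

open import Defs
open import Relation.Binary.PropositionalEquality using (_≡_; refl)
open import Data.Bool using (Bool; true; false; not; _∨_)
open import Data.List.Membership.Propositional using (_∈_)
open import Data.List.Relation.Unary.Any using (here)

module _ (S : Signature) where
  open Signature S

  firstEdge∈ : ∀ {a b} (w : Walk S a b) → a ∈ edgesOf S w
  firstEdge∈ (stop a)         = here refl
  firstEdge∈ (step a _ _ _ _) = here refl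

  startGateway : (g : E) (B : E → Set) → Gateway S g (λ t → t ≡ g) B
  startGateway g B w _ refl _ = firstEdge∈ w

  not-b∨b : (b : Bool) → not b ∨ b ≡ true
  not-b∨b true  = refl
  not-b∨b false = refl

  identityTautology : (φ : Form S) → Tautology S (φ ⇒ φ)
  identityTautology φ v = not-b∨b (eval S v φ)

  gatewayRule : ∀ (g : E) (A B : E → Set) → Gateway S g A B →
                ∀ e → A e → ∀ {φ ψ} → InΦ S A φ → InΦ S B ψ →
                ⊢_ S (φ ⇒ ψ) → ⊢_ S (φ ⇒ □ g ψ)
  gatewayRule g A B gw e e∈A {φ} {ψ} φ∈A ψ∈B ⊢φ⇒ψ =
    mp (gateway g A B gw e e∈A φ ψ φ∈A ψ∈B) (nec e ⊢φ⇒ψ)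

lemma3 : (S : Signature) (e : Signature.E S) (φ : Form S) →
    InΦ S (λ t → t ≡ e) φ → ⊢_ S (φ ⇒ □ e φ)
lemma3 S e φ φ∈e =
  gatewayRule S e onlyE onlyE (startGateway S e onlyE) e refl φ∈e φ∈e
    (taut (identityTautology S φ))
  where
  onlyE : Signature.E S → Set
  onlyE t = t ≡ e
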